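{- Let $w$ be an area sequence (possibly empty), and let $c_0, c_1, \dots, c_k$ be its admissible insertion positions listed in admissible order. Then for every $0 \le i \le k$, \[ \operatorname{dinv}(\operatorname{ins}_{c_i}(w)) = \operatorname{dinv}(w) + i, \] and the word $\operatorname{ins}_{c_i}(w)$ has exactly $i+2$ admissible insertion positions. Moreover, the inserted letter (at position $c_i+1$ of $\operatorname{ins}_{c_i}(w)$) has the maximal value among the letters of $\operatorname{ins}_{c_i}(w)$, and it is the leftmost letter of the rightmost block of consecutive letters equal to this maximal value.
   Context: An area sequence of size $n$ is a word $w = w_1 \dots w_n$ of nonnegative integers with $w_1 = 0$ and $0 \le w_{i+1} \le w_i + 1$ for $1 \le i < n$ (these are in bijection with Dyck paths of size $n$; $w_i$ counts full cells between the $i$-th north step and the diagonal). The empty word is the area sequence of size $0$. Dinv: for an area sequence $w = w_1\dots w_n$ and each $i$, let $d_i$ be the number of indices $j > i$ with $w_j = w_i$ or $w_j = w_i - 1$; then $\operatorname{dinv}(w) = \sum_i d_i$. Insertion: $\operatorname{ins}_0(w) := 0 w_1 \dots w_n$, and for $1 \le i \le n$, $\operatorname{ins}_i(w) := w_1 \dots w_i (w_i+1) w_{i+1} \dots w_n$ (a new letter $w_i+1$ is inserted right after position $i$, becoming position $i+1$). Admissible insertion positions: for a nonempty area sequence $w$ with maximum value $m$, let $\mathrm{Maxb}(w) = \{ i : w_i = m\}$; let $\mathrm{Maxa}(w)$ be the set of positions $i$ with $w_i = m-1$ and $w_j < m$ for all $j > i$; let $i_0(w)$ be the position of the leftmost letter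 of the rightmost block of consecutive letters equal to $m$. The admissible insertion positions are $\mathrm{Maxb}(w) \cup \mathrm{Maxa}(w) \cup \{i_0(w) - 1\}$, and the admissible order on them lists the elements of $\mathrm{Maxb}(w)$ in decreasing order, then the elements of $\mathrm{Maxa}(w)$ in decreasing order, then $i_0(w)-1$. For the empty word, the only admissible insertion position is $0$. -}

module Defs where

open import Data.Nat using (ℕ; zero; suc; _≤_; _∸_; _⊔_; _≡ᵇ_; _≤ᵇ_; _<ᵇ_)
open import Data.Bool using (Bool; true; false; _∧_; _∨_; not)
open import Data.List using (List; []; _∷_; _++_; length; map; reverse; take; drop; upTo; filterᵇ; foldr)
open import Data.Product using (_×_)
open import Data.Unit using (⊤)
open import Relation.Binary.PropositionalEquality using (_≡_)

-- Words are lists of naturals; positions are 1-indexed as in the paper.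

Chain : List ℕ → Set
Chain []            = ⊤
Chain (x ∷ [])      = ⊤
Chain (x ∷ y ∷ r)   = (y ≤ suc x) × Chain (y ∷ r)

IsArea : List ℕ → Set
IsArea []      = ⊤
IsArea (x ∷ r) = (x ≡ 0) × Chain (x ∷ r)

countᵇ : {A : Set} → (A → Bool) → List A → ℕ
countᵇ p []      = 0
countᵇ p (x ∷ r) with p x
... | true  = suc (countᵇ p r)
... | false = countᵇ p r

allᵇ : {A : Set} → (A → Bool) → List A → Bool
allᵇ p []      = true
allᵇ p (x ∷ r) = p x ∧ allᵇ p r

dinv : List ℕ → ℕ
dinv []      = 0
dinv (x ∷ r) = countᵇ (λ y → (y ≡ᵇ x) ∨ (suc y ≡ᵇ x)) r + dinv r
  where open import Data.Nat using (_+_)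

-- 0-indexed lookup with default 0
nth : List ℕ → ℕ → ℕ
nth []      _       = 0
nth (x ∷ r) zero    = x
nth (x ∷ r) (suc k) = nth r k

-- 1-indexed letter w_i (only meaningful for 1 ≤ i ≤ length w)
val : List ℕ → ℕ → ℕ
val w i = nth w (i ∸ 1)

-- maximum letter (for nonempty words this is the maximum value m)
maxL : List ℕ → ℕ
maxL = foldr _⊔_ 0

positions : List ℕ → List ℕ
positions w = map suc (upTo (length w))

ins : ℕ → List ℕ → List ℕ
ins zero    w = 0 ∷ w
ins (suc i) w = take (suc i) w ++ (suc (nth w i) ∷ drop (suc i) w)

maxb : List ℕ → List ℕ
maxb w = reverse (filterᵇ (λ i → val w i ≡ᵇ maxL w) (positions w))

maxa : List ℕ → List ℕ
maxa w = reverse (filterᵇ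
  (λ i → (suc (val w i) ≡ᵇ maxL w)
         ∧ allᵇ (λ j → (j ≤ᵇ i) ∨ (val w j <ᵇ maxL w)) (positions w))
  (positions w))

headOr : ℕ → List ℕ → ℕ
headOr d []      = d
headOr d (x ∷ _) = x

rmax : List ℕ → ℕ
rmax w = headOr 0 (maxb w)

-- i_0(w): leftmost letter of the rightmost block of consecutive letters equal to m,
-- i.e. the least j ≤ rmax w such that w_k = m for all j ≤ k ≤ rmax w
i0 : List ℕ → ℕ
i0 w = headOr 0 (filterᵇ
  (λ j → (j ≤ᵇ rmax w)
         ∧ allᵇ (λ k → not ((j ≤ᵇ k) ∧ (k ≤ᵇ rmax w)) ∨ (val w k ≡ᵇ maxL w)) (positions w))
  (positions w))

admissible : List ℕ → List ℕ
admissible []          = 0 ∷ []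
admissible w@(_ ∷ _)   = maxb w ++ (maxa w ++ ((i0 w ∸ 1) ∷ []))

-- Write w = A · m^(t+1) · C with m the maximum of w and m^(t+1) its rightmost block,
-- so that C < m and A does not end in m. Then i0(w) = |A| + 1, |Maxb(w)| = #m(w) and
-- |Maxa(w)| = #(m−1)(C); this reads off the number of admissible positions of any word.
-- For each admissible c, ins_c(w) again has this shape with the inserted letter starting its
-- rightmost maximal block: after Maxb the new letter m + 1 is alone; after Maxa the new m is the
-- last m; at i0(w) − 1 the new m joins the block, since in an area sequence the letter before it
-- is m − 1. The dinv gained is the number of earlier letters equal to the new letter plus the later
-- letters equal to it or one less, which in all three cases is the number of admissible positions
-- preceding c in admissible order; the same counts give i + 2 admissible positions afterwards.
module Submission where

open import Defs
open import Data.Bool using (Bool; true; false; _∧_; _∨_; not; if_then_else_)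
open import Data.Bool.Properties using (∧-zeroʳ; ∧-identityʳ; ∨-identityʳ; T?)
open import Data.Empty using (⊥-elim)
open import Data.Fin using (Fin; toℕ)
open import Data.List using (List; []; _∷_; _++_; length; lookup; reverse; take; drop; replicate; filterᵇ; applyUpTo)
open import Data.List.Properties
  using (map-applyUpTo; length-reverse; unfold-reverse; length-++; length-drop; length-take; take++drop≡id;
         length-replicate; ++-assoc; ++-identityʳ; reverse-++; drop-drop; filter-++)
open import Data.List.Membership.Propositional using (_∈_)
open import Data.List.Relation.Unary.All as All using (All; []; _∷_)
open import Data.List.Relation.Unary.All.Properties using (++⁺; drop⁺; take⁺; replicate⁺)
open import Data.List.Relation.Unary.Any as Any using (Any; here; there)
open import Data.Nat using (ℕ; zero; suc; _+_; _∸_; _≤_; _<_; _≡ᵇ_; _≤ᵇ_; _<ᵇ_; z≤n; s≤s; z<s; _≤?_)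
open import Data.Nat.Properties
open import Data.Nat.Tactic.RingSolver using (solve-∀)
open import Data.Product using (_×_; _,_)
open import Data.Sum using (inj₁; inj₂)
open import Data.Unit using (⊤; tt)
open import Function using (_∘_)
open import Relation.Nullary using (¬_; yes; no)
open import Relation.Nullary.Reflects using (Reflects; ofʸ; ofⁿ; fromEquivalence)
open import Relation.Binary.PropositionalEquality
open ≡-Reasoning

module _ {P : Set} {b : Bool} where

  reflects-true : Reflects P b → P → b ≡ true
  reflects-true (ofʸ _)  _ = refl
  reflects-true (ofⁿ ¬p) p = ⊥-elim (¬p p)

  reflects-false : Reflects P b → ¬ P → b ≡ false
  reflects-false (ofʸ p) ¬p = ⊥-elim (¬p p)
  reflects-false (ofⁿ _) _  = refl

  reflects-sound : Reflects P b → b ≡ true → P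
  reflects-sound (ofʸ p) _  = p
  reflects-sound (ofⁿ _) ()

  reflects-refute : Reflects P b → b ≡ false → ¬ P
  reflects-refute (ofʸ _)  ()
  reflects-refute (ofⁿ ¬p) _ = ¬p

≡ᵇ-reflects-≡ : ∀ m n → Reflects (m ≡ n) (m ≡ᵇ n)
≡ᵇ-reflects-≡ m n = fromEquivalence (≡ᵇ⇒≡ m n) (≡⇒≡ᵇ m n)

module _ {m n : ℕ} where

  ≡ᵇ-true : m ≡ n → (m ≡ᵇ n) ≡ true
  ≡ᵇ-true = reflects-true (≡ᵇ-reflects-≡ m n)

  ≡ᵇ-false : m ≢ n → (m ≡ᵇ n) ≡ false
  ≡ᵇ-false = reflects-false (≡ᵇ-reflects-≡ m n)

  ≡ᵇ-sound : (m ≡ᵇ n) ≡ true → m ≡ n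
  ≡ᵇ-sound = reflects-sound (≡ᵇ-reflects-≡ m n)

  ≤ᵇ-true : m ≤ n → (m ≤ᵇ n) ≡ true
  ≤ᵇ-true = reflects-true (≤ᵇ-reflects-≤ m n)

  ≤ᵇ-false : ¬ m ≤ n → (m ≤ᵇ n) ≡ false
  ≤ᵇ-false = reflects-false (≤ᵇ-reflects-≤ m n)

  ≤ᵇ-sound : (m ≤ᵇ n) ≡ true → m ≤ n
  ≤ᵇ-sound = reflects-sound (≤ᵇ-reflects-≤ m n)

  ≤ᵇ-refute : (m ≤ᵇ n) ≡ false → ¬ m ≤ n
  ≤ᵇ-refute = reflects-refute (≤ᵇ-reflects-≤ m n)

  <ᵇ-true : m < n → (m <ᵇ n) ≡ true
  <ᵇ-true = reflects-true (<ᵇ-reflects-< m n)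

  <ᵇ-false : ¬ m < n → (m <ᵇ n) ≡ false
  <ᵇ-false = reflects-false (<ᵇ-reflects-< m n)

≡ᵇ-refl : ∀ m → (m ≡ᵇ m) ≡ true
≡ᵇ-refl m = ≡ᵇ-true {m} {m} refl

≡ᵇ-sym : ∀ m n → (m ≡ᵇ n) ≡ (n ≡ᵇ m)
≡ᵇ-sym zero    zero    = refl
≡ᵇ-sym zero    (suc n) = refl
≡ᵇ-sym (suc m) zero    = refl
≡ᵇ-sym (suc m) (suc n) = ≡ᵇ-sym m n

∧-trueˡ : ∀ {a b} → a ∧ b ≡ true → a ≡ true
∧-trueˡ {true} _ = refl

module _ {A : Set} where

  countᵇ-∷ : ∀ (p : A → Bool) x xs → countᵇ p (x ∷ xs) ≡ (if p x then 1 else 0) + countᵇ p xs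
  countᵇ-∷ p x xs with p x
  ... | true  = refl
  ... | false = refl

  countᵇ-++ : ∀ (p : A → Bool) xs ys → countᵇ p (xs ++ ys) ≡ countᵇ p xs + countᵇ p ys
  countᵇ-++ p []       ys = refl
  countᵇ-++ p (x ∷ xs) ys with p x
  ... | true  = cong suc (countᵇ-++ p xs ys)
  ... | false = countᵇ-++ p xs ys

  countᵇ-cong : ∀ {P : A → Set} {p q : A → Bool} {xs} → All P xs → (∀ {x} → P x → p x ≡ q x) →
                countᵇ p xs ≡ countᵇ q xs
  countᵇ-cong []                                h = refl
  countᵇ-cong {p = p} {q} {x ∷ xs} (px ∷ pxs) h = begin
    countᵇ p (x ∷ xs)                     ≡⟨ countᵇ-∷ p x xs ⟩
    (if p x then 1 else 0) + countᵇ p xs  ≡⟨ cong₂ (λ b n → (if b then 1 else 0) + n) (h px) (countᵇ-cong pxs h) ⟩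
    (if q x then 1 else 0) + countᵇ q xs  ≡⟨ sym (countᵇ-∷ q x xs) ⟩
    countᵇ q (x ∷ xs)                     ∎

  countᵇ-none : ∀ (p : A → Bool) {xs} → All (λ x → p x ≡ false) xs → countᵇ p xs ≡ 0
  countᵇ-none p []                   = refl
  countᵇ-none p {x ∷ xs} (px ∷ pxs) with p x
  countᵇ-none p (()  ∷ pxs) | true
  countᵇ-none p (px ∷ pxs)  | false = countᵇ-none p pxs

  countᵇ-replicate : ∀ (p : A → Bool) {x} k → p x ≡ true → countᵇ p (replicate k x) ≡ k
  countᵇ-replicate p     zero    px = refl
  countᵇ-replicate p {x} (suc k) px =
    trans (countᵇ-∷ p x (replicate k x)) (cong₂ (λ b n → (if b then 1 else 0) + n) px (countᵇ-replicate p k px))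

  length-filterᵇ : ∀ (p : A → Bool) xs → length (filterᵇ p xs) ≡ countᵇ p xs
  length-filterᵇ p []       = refl
  length-filterᵇ p (x ∷ xs) with p x
  ... | true  = cong suc (length-filterᵇ p xs)
  ... | false = length-filterᵇ p xs

  filterᵇ-none : ∀ (p : A → Bool) {xs} → All (λ x → p x ≡ false) xs → filterᵇ p xs ≡ []
  filterᵇ-none p []                   = refl
  filterᵇ-none p {x ∷ xs} (px ∷ pxs) with p x
  filterᵇ-none p (()  ∷ pxs) | true
  filterᵇ-none p (px ∷ pxs)  | false = filterᵇ-none p pxs

  filterᵇ-accept : ∀ (p : A → Bool) {x} xs → p x ≡ true → filterᵇ p (x ∷ xs) ≡ x ∷ filterᵇ p xs
  filterᵇ-accept p {x} xs px with p x
  ... | true = refl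

  allᵇ-true : ∀ {q : A → Bool} {xs} → All (λ x → q x ≡ true) xs → allᵇ q xs ≡ true
  allᵇ-true []         = refl
  allᵇ-true (qx ∷ qxs) = cong₂ _∧_ qx (allᵇ-true qxs)

  allᵇ-false : ∀ {q : A → Bool} {xs} → Any (λ x → q x ≡ false) xs → allᵇ q xs ≡ false
  allᵇ-false {q} {x ∷ xs} (here qx) = cong (_∧ allᵇ q xs) qx
  allᵇ-false {q} {x ∷ xs} (there a) = trans (cong (q x ∧_) (allᵇ-false a)) (∧-zeroʳ (q x))

  drop-length-++ : ∀ (xs ys : List A) → drop (length xs) (xs ++ ys) ≡ ys
  drop-length-++ []       ys = refl
  drop-length-++ (x ∷ xs) ys = drop-length-++ xs ys

  take-length-++ : ∀ (xs ys : List A) → take (length xs) (xs ++ ys) ≡ xs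
  take-length-++ []       ys = refl
  take-length-++ (x ∷ xs) ys = cong (x ∷_) (take-length-++ xs ys)

interval : ℕ → ℕ → List ℕ
interval s zero    = []
interval s (suc k) = s ∷ interval (suc s) k

Within : ℕ → ℕ → ℕ → Set
Within s k j = s ≤ j × j < s + k

interval-++ : ∀ s k l → interval s (k + l) ≡ interval s k ++ interval (s + k) l
interval-++ s zero    l = cong (λ z → interval z l) (sym (+-identityʳ s))
interval-++ s (suc k) l = cong (s ∷_) (trans (interval-++ (suc s) k l) (cong (λ z → interval (suc s) k ++ interval z l) (sym (+-suc s k))))

Within-head : ∀ s k → Within s (suc k) s
Within-head s k = ≤-refl , m<m+n s z<s

Within-tail : ∀ {s k j} → Within (suc s) k j → Within s (suc k) j
Within-tail {s} {k} {j} (s<j , j<) = <⇒≤ s<j , subst (j <_) (sym (+-suc s k)) j<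

All-Within-interval : ∀ s k → All (Within s k) (interval s k)
All-Within-interval s zero    = []
All-Within-interval s (suc k) = Within-head s k ∷ All.map Within-tail (All-Within-interval (suc s) k)

∈-interval : ∀ {s k j} → Within s k j → j ∈ interval s k
∈-interval {s} {zero}  {j} (s≤j , j<) = ⊥-elim (<-irrefl refl (≤-<-trans s≤j (subst (j <_) (+-identityʳ s) j<)))
∈-interval {s} {suc k} {j} (s≤j , j<) with m≤n⇒m<n∨m≡n s≤j
... | inj₂ refl = here refl
... | inj₁ s<j  = there (∈-interval (s<j , subst (j <_) (+-suc s k) j<))

applyUpTo-interval : ∀ (f : ℕ → ℕ) s k → (∀ i → f i ≡ s + i) → applyUpTo f k ≡ interval s k
applyUpTo-interval f s zero    h = refl
applyUpTo-interval f s (suc k) h =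
  cong₂ _∷_ (trans (h 0) (+-identityʳ s)) (applyUpTo-interval (f ∘ suc) (suc s) k (λ i → trans (h (suc i)) (+-suc s i)))

positions-interval : ∀ w → positions w ≡ interval 1 (length w)
positions-interval w = trans (map-applyUpTo (λ i → i) suc (length w)) (applyUpTo-interval suc 1 (length w) (λ _ → refl))

nth-++ˡ : ∀ xs ys j → j < length xs → nth (xs ++ ys) j ≡ nth xs j
nth-++ˡ (x ∷ xs) ys zero    _         = refl
nth-++ˡ (x ∷ xs) ys (suc j) (s≤s j<) = nth-++ˡ xs ys j j<

nth-++ʳ : ∀ xs ys j → length xs ≤ j → nth (xs ++ ys) j ≡ nth ys (j ∸ length xs)
nth-++ʳ []       ys j       _         = refl
nth-++ʳ (x ∷ xs) ys (suc j) (s≤s le) = nth-++ʳ xs ys j le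

nth-replicate-++ : ∀ k x ys j → j < k → nth (replicate k x ++ ys) j ≡ x
nth-replicate-++ (suc k) x ys zero    _         = refl
nth-replicate-++ (suc k) x ys (suc j) (s≤s j<) = nth-replicate-++ k x ys j j<

nth-take : ∀ w c j → j < c → nth (take c w) j ≡ nth w j
nth-take []      (suc c) j       _         = refl
nth-take (x ∷ w) (suc c) zero    _         = refl
nth-take (x ∷ w) (suc c) (suc j) (s≤s j<) = nth-take w c j j<

nth-All : ∀ {P : ℕ → Set} xs j → All P xs → j < length xs → P (nth xs j)
nth-All (x ∷ xs) zero    (px ∷ _)   _         = px
nth-All (x ∷ xs) (suc j) (_  ∷ pxs) (s≤s j<) = nth-All xs j pxs j<

-- no range hypothesis: out of range, nth returns 0
nth-≤ : ∀ {M} xs j → All (_≤ M) xs → nth xs j ≤ M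
nth-≤ []       j       _          = z≤n
nth-≤ (x ∷ xs) zero    (x≤ ∷ _)   = x≤
nth-≤ (x ∷ xs) (suc j) (_  ∷ xs≤) = nth-≤ xs j xs≤

maxL-≤ : ∀ {M} xs → All (_≤ M) xs → maxL xs ≤ M
maxL-≤ []       _          = z≤n
maxL-≤ (x ∷ xs) (x≤ ∷ xs≤) = ⊔-lub x≤ (maxL-≤ xs xs≤)

nth-≤-maxL : ∀ xs j → j < length xs → nth xs j ≤ maxL xs
nth-≤-maxL (x ∷ xs) zero    _         = m≤m⊔n x (maxL xs)
nth-≤-maxL (x ∷ xs) (suc j) (s≤s j<) = ≤-trans (nth-≤-maxL xs j j<) (m≤n⊔m x (maxL xs))

All-≤-maxL : ∀ xs → All (_≤ maxL xs) xs
All-≤-maxL []       = []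
All-≤-maxL (x ∷ xs) = m≤m⊔n x (maxL xs) ∷ All.map (λ le → ≤-trans le (m≤n⊔m x (maxL xs))) (All-≤-maxL xs)

maxL-∈ : ∀ x xs → maxL (x ∷ xs) ∈ x ∷ xs
maxL-∈ x []       = here (⊔-identityʳ x)
maxL-∈ x (y ∷ ys) with ⊔-sel x (maxL (y ∷ ys))
... | inj₁ e = here e
... | inj₂ e = there (subst (_∈ y ∷ ys) (sym e) (maxL-∈ y ys))

chain-nth : ∀ w → Chain w → ∀ j → suc j < length w → nth w (suc j) ≤ suc (nth w j)
chain-nth (x ∷ [])    _       zero    (s≤s ())
chain-nth (x ∷ y ∷ r) (h , _) zero    _         = h
chain-nth (x ∷ y ∷ r) (_ , c) (suc j) (s≤s j<) = chain-nth (y ∷ r) c j j<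

Indexed : (ℕ → ℕ → Set) → ℕ → List ℕ → Set
Indexed Q k []       = ⊤
Indexed Q k (x ∷ xs) = Q x k × Indexed Q (suc k) xs

Indexed-lookup : ∀ {Q k} xs → Indexed Q k xs → (i : Fin (length xs)) → Q (lookup xs i) (k + toℕ i)
Indexed-lookup {Q} {k} (x ∷ xs) (q , _)  Fin.zero    = subst (Q x) (sym (+-identityʳ k)) q
Indexed-lookup {Q} {k} (x ∷ xs) (_ , qs) (Fin.suc i) =
  subst (Q (lookup xs i)) (sym (+-suc k (toℕ i))) (Indexed-lookup xs qs i)

Indexed-++ : ∀ {Q k} xs ys → Indexed Q k xs → Indexed Q (k + length xs) ys → Indexed Q k (xs ++ ys)
Indexed-++ {Q} {k} []       ys _        h = subst (λ z → Indexed Q z ys) (+-identityʳ k) h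
Indexed-++ {Q} {k} (x ∷ xs) ys (q , qs) h =
  q , Indexed-++ xs ys qs (subst (λ z → Indexed Q z ys) (+-suc k (length xs)) h)

-- the index of an element of reverse xs is the length of its tail in xs
IndexedByTail : (ℕ → ℕ → Set) → List ℕ → Set
IndexedByTail Q []       = ⊤
IndexedByTail Q (x ∷ xs) = Q x (length xs) × IndexedByTail Q xs

Indexed-reverse : ∀ {Q k} xs → IndexedByTail (λ x j → Q x (k + j)) xs → Indexed Q k (reverse xs)
Indexed-reverse          []       _        = tt
Indexed-reverse {Q} {k} (x ∷ xs) (q , qs) = subst (Indexed Q k) (sym (unfold-reverse x xs))
  (Indexed-++ (reverse xs) (x ∷ []) (Indexed-reverse xs qs)
     (subst (λ z → Q x (k + z)) (sym (length-reverse xs)) q , tt))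

filterᵇ-IndexedByTail : ∀ (P : ℕ → Bool) Q N s k → s + k ≡ N →
  (∀ j → s ≤ j → j < N → P j ≡ true → Q j (countᵇ P (interval (suc j) (N ∸ suc j)))) →
  IndexedByTail Q (filterᵇ P (interval s k))
filterᵇ-IndexedByTail P Q N s zero    e h = tt
filterᵇ-IndexedByTail P Q N s (suc k) e h with P s in Ps
... | false = filterᵇ-IndexedByTail P Q N (suc s) k (trans (sym (+-suc s k)) e) (λ j s<j → h j (<⇒≤ s<j))
... | true  = subst (Q s) (sym (length-filterᵇ P (interval (suc s) k)))
                (subst (λ z → Q s (countᵇ P (interval (suc s) z))) N∸s≡k (h s ≤-refl s<N Ps))
            , filterᵇ-IndexedByTail P Q N (suc s) k (trans (sym (+-suc s k)) e) (λ j s<j → h j (<⇒≤ s<j))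
  where
  N∸s≡k : N ∸ suc s ≡ k
  N∸s≡k = trans (cong (_∸ suc s) (trans (sym e) (+-suc s k))) (m+n∸m≡n (suc s) k)
  s<N : s < N
  s<N = subst (s <_) e (m<m+n s z<s)

-- a letter y to the right of x contributes to dinv
dinvPair : ℕ → ℕ → Bool
dinvPair x y = (y ≡ᵇ x) ∨ (suc y ≡ᵇ x)

dinv-insert : ∀ xs x ys →
  dinv (xs ++ x ∷ ys) ≡ dinv (xs ++ ys) + countᵇ (λ y → dinvPair y x) xs + countᵇ (dinvPair x) ys
dinv-insert []       x ys = trans (+-comm (countᵇ (dinvPair x) ys) (dinv ys))
                                  (cong (_+ countᵇ (dinvPair x) ys) (sym (+-identityʳ (dinv ys))))
dinv-insert (y ∷ xs) x ys = begin
  countᵇ (dinvPair y) (xs ++ x ∷ ys) + dinv (xs ++ x ∷ ys)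
    ≡⟨ cong₂ _+_ (trans (countᵇ-++ (dinvPair y) xs (x ∷ ys)) (cong (countᵇ (dinvPair y) xs +_) (countᵇ-∷ (dinvPair y) x ys)))
                 (dinv-insert xs x ys) ⟩
  countᵇ (dinvPair y) xs + (δ + countᵇ (dinvPair y) ys) + (dinv (xs ++ ys) + U + D)
    ≡⟨ regroup (countᵇ (dinvPair y) xs) δ (countᵇ (dinvPair y) ys) (dinv (xs ++ ys)) U D ⟩
  (countᵇ (dinvPair y) xs + countᵇ (dinvPair y) ys + dinv (xs ++ ys)) + (δ + U) + D
    ≡⟨ cong₂ (λ p q → p + q + D) (cong (_+ dinv (xs ++ ys)) (sym (countᵇ-++ (dinvPair y) xs ys)))
                                 (sym (countᵇ-∷ (λ z → dinvPair z x) y xs)) ⟩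
  dinv ((y ∷ xs) ++ ys) + countᵇ (λ z → dinvPair z x) (y ∷ xs) + D ∎
  where
  δ = if dinvPair y x then 1 else 0
  U = countᵇ (λ z → dinvPair z x) xs
  D = countᵇ (dinvPair x) ys
  regroup : ∀ p δ q r s t → (p + (δ + q)) + (r + s + t) ≡ (p + q + r) + (δ + s) + t
  regroup = solve-∀

record RightmostBlock (u : List ℕ) (M : ℕ) : Set where
  constructor block
  field
    prefix       : List ℕ
    extra        : ℕ
    suffix       : List ℕ
    split        : u ≡ prefix ++ (replicate (suc extra) M ++ suffix)
    prefix≤      : All (_≤ M) prefix
    suffix<      : All (_< M) suffix
    prefix-last≢ : ∀ k → suc k ≡ length prefix → nth prefix k ≢ M

All-<-of-∉ : ∀ {M} xs → All (_≤ M) xs → ¬ M ∈ xs → All (_< M) xs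
All-<-of-∉ []       _          _   = []
All-<-of-∉ (x ∷ xs) (x≤ ∷ xs≤) M∉ = ≤∧≢⇒< x≤ (λ e → M∉ (here (sym e))) ∷ All-<-of-∉ xs xs≤ (M∉ ∘ there)

rightmostBlock : ∀ M u → All (_≤ M) u → M ∈ u → RightmostBlock u M
rightmostBlock M (x ∷ xs) (x≤ ∷ xs≤) M∈ with Any.any? (M ≟_) xs
rightmostBlock M (x ∷ xs) (x≤ ∷ xs≤) (here e)   | no M∉ = block [] 0 xs (cong (_∷ xs) (sym e)) [] (All-<-of-∉ xs xs≤ M∉) (λ _ ())
rightmostBlock M (x ∷ xs) (x≤ ∷ xs≤) (there M∈) | no M∉ = ⊥-elim (M∉ M∈)
... | yes M∈xs with rightmostBlock M xs xs≤ M∈xs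
...   | block [] t C split _ C< _ with x ≟ M
...     | yes refl = block [] (suc t) C (cong (x ∷_) split) [] C< (λ _ ())
...     | no x≢M   = block (x ∷ []) t C (cong (x ∷_) split) (x≤ ∷ []) C< last≢
  where
  last≢ : ∀ k → suc k ≡ 1 → nth (x ∷ []) k ≢ M
  last≢ zero _ = x≢M
rightmostBlock M (x ∷ xs) (x≤ ∷ xs≤) _ | yes _ | block (y ∷ A) t C split A≤ C< last≢ =
  block (x ∷ y ∷ A) t C (cong (x ∷_) split) (x≤ ∷ A≤) C< last≢′
  where
  last≢′ : ∀ k → suc k ≡ length (x ∷ y ∷ A) → nth (x ∷ y ∷ A) k ≢ M
  last≢′ (suc k) e = last≢ k (suc-injective e)

maxBlock : ∀ x xs → RightmostBlock (x ∷ xs) (maxL (x ∷ xs))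
maxBlock x xs = rightmostBlock (maxL (x ∷ xs)) (x ∷ xs) (All-≤-maxL (x ∷ xs)) (maxL-∈ x xs)

inMaxb : List ℕ → ℕ → Bool
inMaxb u i = val u i ≡ᵇ maxL u

inMaxa : List ℕ → ℕ → Bool
inMaxa u i = (suc (val u i) ≡ᵇ maxL u) ∧ allᵇ (λ j → (j ≤ᵇ i) ∨ (val u j <ᵇ maxL u)) (positions u)

inI0 : List ℕ → ℕ → Bool
inI0 u j = (j ≤ᵇ rmax u) ∧ allᵇ (λ k → not ((j ≤ᵇ k) ∧ (k ≤ᵇ rmax u)) ∨ (val u k ≡ᵇ maxL u)) (positions u)

countᵇ-val : ∀ (f : ℕ → Bool) u s ys zs → drop s u ≡ ys ++ zs →
  countᵇ (f ∘ val u) (interval (suc s) (length ys)) ≡ countᵇ f ys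
countᵇ-val f u s []       zs e = refl
countᵇ-val f u s (y ∷ ys) zs e = begin
  countᵇ (f ∘ val u) (interval (suc s) (suc (length ys)))
    ≡⟨ countᵇ-∷ (f ∘ val u) (suc s) _ ⟩
  (if f (nth u s) then 1 else 0) + countᵇ (f ∘ val u) (interval (suc (suc s)) (length ys))
    ≡⟨ cong₂ (λ v n → (if f v then 1 else 0) + n) (nth-drop u s e) (countᵇ-val f u (suc s) ys zs (drop-suc u s e)) ⟩
  (if f y then 1 else 0) + countᵇ f ys
    ≡⟨ sym (countᵇ-∷ f y ys) ⟩
  countᵇ f (y ∷ ys) ∎
  where
  nth-drop : ∀ u s {r} → drop s u ≡ y ∷ r → nth u s ≡ y
  nth-drop (x ∷ u) zero    refl = refl
  nth-drop (x ∷ u) (suc s) e    = nth-drop u s e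
  drop-suc : ∀ u s {r} → drop s u ≡ y ∷ r → drop (suc s) u ≡ r
  drop-suc (x ∷ u) zero    refl = refl
  drop-suc (x ∷ u) (suc s) e    = drop-suc u s e

countᵇ-val-drop : ∀ (f : ℕ → Bool) u c → countᵇ (f ∘ val u) (interval (suc c) (length u ∸ c)) ≡ countᵇ f (drop c u)
countᵇ-val-drop f u c = trans (cong (λ z → countᵇ (f ∘ val u) (interval (suc c) z)) (sym (length-drop c u)))
                              (countᵇ-val f u c (drop c u) [] (sym (++-identityʳ _)))

positions-split : ∀ u c → c ≤ length u → positions u ≡ interval 1 c ++ interval (suc c) (length u ∸ c)
positions-split u c c≤n = begin
  positions u                                         ≡⟨ positions-interval u ⟩
  interval 1 (length u)                               ≡⟨ cong (interval 1) (sym (m+[n∸m]≡n c≤n)) ⟩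
  interval 1 (c + (length u ∸ c))                     ≡⟨ interval-++ 1 c (length u ∸ c) ⟩
  interval 1 c ++ interval (suc c) (length u ∸ c)     ∎

module RightmostBlockFacts {u M} (b : RightmostBlock u M) where
  open RightmostBlock b public

  start : ℕ
  start = length prefix

  -- 1-indexed position of the last letter of the block
  end : ℕ
  end = suc (start + extra)

  n : ℕ
  n = length u

  length-prefix-block : length (prefix ++ replicate (suc extra) M) ≡ end
  length-prefix-block = trans (length-++ prefix) (trans (cong (start +_) (length-replicate (suc extra))) (+-suc start extra))

  split′ : u ≡ (prefix ++ replicate (suc extra) M) ++ suffix
  split′ = trans split (sym (++-assoc prefix (replicate (suc extra) M) suffix))

  length-u : n ≡ end + length suffix
  length-u = trans (cong length split′) (trans (length-++ (prefix ++ replicate (suc extra) M)) (cong (_+ length suffix) length-prefix-block))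

  end≤n : end ≤ n
  end≤n = subst (end ≤_) (sym length-u) (m≤m+n end (length suffix))

  start<n : start < n
  start<n = <-≤-trans (s≤s (m≤m+n start extra)) end≤n

  All≤M : All (_≤ M) u
  All≤M = subst (All (_≤ M)) (sym split) (++⁺ prefix≤ (++⁺ (replicate⁺ (suc extra) ≤-refl) (All.map <⇒≤ suffix<)))

  nth-block : ∀ j → start ≤ j → j < end → nth u j ≡ M
  nth-block j start≤j j<end = begin
    nth u j                                            ≡⟨ cong (λ z → nth z j) split ⟩
    nth (prefix ++ (replicate (suc extra) M ++ suffix)) j ≡⟨ nth-++ʳ prefix _ j start≤j ⟩
    nth (replicate (suc extra) M ++ suffix) (j ∸ start)   ≡⟨ nth-replicate-++ (suc extra) M suffix (j ∸ start) j∸start< ⟩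
    M ∎
    where
    j∸start< : j ∸ start < suc extra
    j∸start< = subst (j ∸ start <_) (m+n∸m≡n start (suc extra))
                 (∸-monoˡ-< (subst (j <_) (sym (+-suc start extra)) j<end) start≤j)

  nth-suffix : ∀ j → end ≤ j → j < n → nth u j < M
  nth-suffix j end≤j j<n = subst (_< M) (sym nth-u≡) (nth-All suffix (j ∸ l) suffix< j∸l<)
    where
    l = length (prefix ++ replicate (suc extra) M)
    l≤j : l ≤ j
    l≤j = subst (_≤ j) (sym length-prefix-block) end≤j
    nth-u≡ : nth u j ≡ nth suffix (j ∸ l)
    nth-u≡ = trans (cong (λ z → nth z j) split′) (nth-++ʳ (prefix ++ replicate (suc extra) M) suffix j l≤j)
    j∸l< : j ∸ l < length suffix
    j∸l< = subst (λ z → j ∸ z < length suffix) (sym length-prefix-block)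
             (subst (j ∸ end <_) (m+n∸m≡n end (length suffix)) (∸-monoˡ-< (subst (j <_) length-u j<n) end≤j))

  nth-before-block≢ : ∀ k → suc k ≡ start → nth u k ≢ M
  nth-before-block≢ k e = subst (_≢ M) (sym nth-u≡) (prefix-last≢ k e)
    where
    nth-u≡ : nth u k ≡ nth prefix k
    nth-u≡ = trans (cong (λ z → nth z k) split) (nth-++ˡ prefix _ k (subst (k <_) e ≤-refl))

  val-block : ∀ j → start < j → j ≤ end → val u j ≡ M
  val-block (suc j) (s≤s start≤j) j<end = nth-block j start≤j j<end

  val-after-block : ∀ j → end < j → j ≤ n → val u j < M
  val-after-block (suc j) (s≤s end≤j) j<n = nth-suffix j end≤j j<n

  take-start : take start u ≡ prefix
  take-start = trans (cong (take start) split) (take-length-++ prefix _)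

  drop-start : drop start u ≡ replicate (suc extra) M ++ suffix
  drop-start = trans (cong (drop start) split) (drop-length-++ prefix _)

  drop-end : drop end u ≡ suffix
  drop-end = trans (cong (λ z → drop z u) (sym length-prefix-block))
               (trans (cong (drop (length (prefix ++ replicate (suc extra) M))) split′)
                 (drop-length-++ (prefix ++ replicate (suc extra) M) suffix))

  maxL≡ : maxL u ≡ M
  maxL≡ = ≤-antisym (maxL-≤ u All≤M)
            (subst (_≤ maxL u) (nth-block start ≤-refl (s≤s (m≤m+n start extra))) (nth-≤-maxL u start start<n))

  val-start : val u (suc start) ≡ maxL u
  val-start = trans (val-block (suc start) ≤-refl (s≤s (m≤m+n start extra))) (sym maxL≡)

  All-Within-positions : All (Within 1 n) (positions u)
  All-Within-positions = subst (All (Within 1 n)) (sym (positions-interval u)) (All-Within-interval 1 n)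

  ∈-positions : ∀ {j} → 1 ≤ j → j ≤ n → j ∈ positions u
  ∈-positions 1≤j j≤n = subst (_ ∈_) (sym (positions-interval u)) (∈-interval (1≤j , s≤s j≤n))

  after-block : ∀ {j} → Within (suc end) (length suffix) j → end < j × j ≤ n
  after-block {j} (end<j , j<) = end<j , ≤-pred (subst (j <_) (cong suc (sym length-u)) j<)

  val-end : val u end ≡ maxL u
  val-end = trans (val-block end (s≤s (m≤m+n start extra)) ≤-refl) (sym maxL≡)

  maxb-rank : ∀ c → countᵇ (inMaxb u) (interval (suc c) (n ∸ c)) ≡ countᵇ (_≡ᵇ M) (drop c u)
  maxb-rank c = trans (countᵇ-val-drop (_≡ᵇ maxL u) u c) (cong (λ z → countᵇ (_≡ᵇ z) (drop c u)) maxL≡)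

  length-maxb : length (maxb u) ≡ countᵇ (_≡ᵇ M) u
  length-maxb = begin
    length (maxb u)                              ≡⟨ length-reverse (filterᵇ (inMaxb u) (positions u)) ⟩
    length (filterᵇ (inMaxb u) (positions u))    ≡⟨ length-filterᵇ (inMaxb u) (positions u) ⟩
    countᵇ (inMaxb u) (positions u)              ≡⟨ cong (countᵇ (inMaxb u)) (positions-interval u) ⟩
    countᵇ (inMaxb u) (interval 1 n)             ≡⟨ maxb-rank 0 ⟩
    countᵇ (_≡ᵇ M) u                             ∎

  rmax≡ : rmax u ≡ end
  rmax≡ = cong (headOr 0) (begin
    reverse (filterᵇ (inMaxb u) (positions u))
      ≡⟨ cong (reverse ∘ filterᵇ (inMaxb u)) positions≡ ⟩
    reverse (filterᵇ (inMaxb u) (interval 1 (start + extra) ++ end ∷ interval (suc end) (length suffix)))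
      ≡⟨ cong reverse (filter-++ (T? ∘ inMaxb u) (interval 1 (start + extra)) _) ⟩
    reverse (F ++ filterᵇ (inMaxb u) (end ∷ interval (suc end) (length suffix)))
      ≡⟨ cong (λ z → reverse (F ++ z)) (trans (filterᵇ-accept (inMaxb u) _ (≡ᵇ-true val-end)) (cong (end ∷_) (filterᵇ-none (inMaxb u) after))) ⟩
    reverse (F ++ end ∷ [])
      ≡⟨ reverse-++ F (end ∷ []) ⟩
    end ∷ reverse F ∎)
    where
    F = filterᵇ (inMaxb u) (interval 1 (start + extra))
    positions≡ : positions u ≡ interval 1 (start + extra) ++ end ∷ interval (suc end) (length suffix)
    positions≡ = trans (positions-split u (start + extra) (≤-trans (n≤1+n _) end≤n))
                   (cong (λ z → interval 1 (start + extra) ++ interval end z)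
                     (trans (cong (_∸ (start + extra)) (trans length-u (sym (+-suc (start + extra) (length suffix)))))
                       (m+n∸m≡n (start + extra) (suc (length suffix)))))
    after : All (λ j → inMaxb u j ≡ false) (interval (suc end) (length suffix))
    after = All.map (λ w → let (end<j , j≤n) = after-block w in
                             ≡ᵇ-false (λ e → <-irrefl (trans e maxL≡) (val-after-block _ end<j j≤n)))
                    (All-Within-interval (suc end) (length suffix))

  inI0-prefix : ∀ {j} → Within 1 start j → inI0 u j ≡ false
  inI0-prefix {j} (1≤j , j<1+start) =
    trans (cong ((j ≤ᵇ rmax u) ∧_) (allᵇ-false (Any.map (λ { refl → test-fails }) start∈))) (∧-zeroʳ _)
    where
    1≤start : 1 ≤ start
    1≤start = ≤-trans 1≤j (≤-pred j<1+start)
    start∈ : start ∈ positions u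
    start∈ = ∈-positions 1≤start (<⇒≤ start<n)
    test-fails : (not ((j ≤ᵇ start) ∧ (start ≤ᵇ rmax u)) ∨ (val u start ≡ᵇ maxL u)) ≡ false
    test-fails = cong₂ (λ x y → not x ∨ y)
      (cong₂ _∧_ (≤ᵇ-true (≤-pred j<1+start)) (trans (cong (start ≤ᵇ_) rmax≡) (≤ᵇ-true (≤-trans (n≤1+n start) (s≤s (m≤m+n start extra))))))
      (≡ᵇ-false (λ e → nth-before-block≢ (start ∸ 1) (m+[n∸m]≡n 1≤start) (trans e maxL≡)))

  inI0-start : inI0 u (suc start) ≡ true
  inI0-start = cong₂ _∧_ (trans (cong (suc start ≤ᵇ_) rmax≡) (≤ᵇ-true (s≤s (m≤m+n start extra))))
                         (allᵇ-true (All.universal test (positions u)))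
    where
    test : ∀ k → (not ((suc start ≤ᵇ k) ∧ (k ≤ᵇ rmax u)) ∨ (val u k ≡ᵇ maxL u)) ≡ true
    test k with suc start ≤ᵇ k in e₁ | k ≤ᵇ rmax u in e₂
    ... | true  | true  = ≡ᵇ-true (trans (val-block k (≤ᵇ-sound e₁) (subst (k ≤_) rmax≡ (≤ᵇ-sound e₂))) (sym maxL≡))
    ... | true  | false = refl
    ... | false | _     = refl

  i0≡ : i0 u ≡ suc start
  i0≡ = cong (headOr 0) (begin
    filterᵇ (inI0 u) (positions u)
      ≡⟨ cong (filterᵇ (inI0 u)) positions≡ ⟩
    filterᵇ (inI0 u) (interval 1 start ++ suc start ∷ interval (suc (suc start)) (extra + length suffix))
      ≡⟨ filter-++ (T? ∘ inI0 u) (interval 1 start) _ ⟩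
    filterᵇ (inI0 u) (interval 1 start) ++ filterᵇ (inI0 u) (suc start ∷ interval (suc (suc start)) (extra + length suffix))
      ≡⟨ cong₂ _++_ (filterᵇ-none (inI0 u) (All.map inI0-prefix (All-Within-interval 1 start))) (filterᵇ-accept (inI0 u) _ inI0-start) ⟩
    suc start ∷ filterᵇ (inI0 u) (interval (suc (suc start)) (extra + length suffix)) ∎)
    where
    regroup : ∀ a e l → suc (a + e) + l ≡ a + suc (e + l)
    regroup = solve-∀
    positions≡ : positions u ≡ interval 1 start ++ suc start ∷ interval (suc (suc start)) (extra + length suffix)
    positions≡ = trans (positions-split u start (<⇒≤ start<n))
                   (cong (λ z → interval 1 start ++ interval (suc start) z)
                     (trans (cong (_∸ start) (trans length-u (regroup start extra (length suffix))))
                       (m+n∸m≡n start (suc (extra + length suffix)))))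

  inMaxa-upto-end : ∀ {j} → Within 1 end j → inMaxa u j ≡ false
  inMaxa-upto-end {j} (1≤j , j<1+end) with suc (val u j) ≡ᵇ maxL u in e
  ... | false = refl
  ... | true  = allᵇ-false (Any.map (λ { refl → test-fails }) (∈-positions (s≤s z≤n) end≤n))
    where
    end≰j : ¬ end ≤ j
    end≰j end≤j = 1+n≢n (trans (cong suc (sym (subst (λ z → val u z ≡ maxL u) (≤-antisym end≤j (≤-pred j<1+end)) val-end)))
                               (≡ᵇ-sound e))
    test-fails : ((end ≤ᵇ j) ∨ (val u end <ᵇ maxL u)) ≡ false
    test-fails = cong₂ _∨_ (≤ᵇ-false end≰j) (<ᵇ-false (λ lt → <-irrefl val-end lt))

  inMaxa-after-block : ∀ j → end < j → inMaxa u j ≡ (suc (val u j) ≡ᵇ maxL u)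
  inMaxa-after-block j end<j =
    trans (cong ((suc (val u j) ≡ᵇ maxL u) ∧_) (allᵇ-true (All.map test All-Within-positions))) (∧-identityʳ _)
    where
    test : ∀ {k} → Within 1 n k → ((k ≤ᵇ j) ∨ (val u k <ᵇ maxL u)) ≡ true
    test {k} (_ , k<1+n) with k ≤ᵇ j in e
    ... | true  = refl
    ... | false = <ᵇ-true (subst (val u k <_) (sym maxL≡)
                    (val-after-block k (<-trans end<j (≰⇒> (≤ᵇ-refute e))) (≤-pred k<1+n)))

  maxa-rank : ∀ c → end ≤ c → c ≤ n →
    countᵇ (inMaxa u) (interval (suc c) (n ∸ c)) ≡ countᵇ (λ y → suc y ≡ᵇ M) (drop c u)
  maxa-rank c end≤c c≤n = begin
    countᵇ (inMaxa u) (interval (suc c) (n ∸ c))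
      ≡⟨ countᵇ-cong (All-Within-interval (suc c) (n ∸ c)) agree ⟩
    countᵇ ((λ y → suc y ≡ᵇ maxL u) ∘ val u) (interval (suc c) (n ∸ c))
      ≡⟨ countᵇ-val-drop (λ y → suc y ≡ᵇ maxL u) u c ⟩
    countᵇ (λ y → suc y ≡ᵇ maxL u) (drop c u)
      ≡⟨ cong (λ z → countᵇ (λ y → suc y ≡ᵇ z) (drop c u)) maxL≡ ⟩
    countᵇ (λ y → suc y ≡ᵇ M) (drop c u) ∎
    where
    agree : ∀ {j} → Within (suc c) (n ∸ c) j → inMaxa u j ≡ (suc (val u j) ≡ᵇ maxL u)
    agree {j} (c<j , _) = inMaxa-after-block j (≤-<-trans end≤c c<j)

  length-maxa : length (maxa u) ≡ countᵇ (λ y → suc y ≡ᵇ M) suffix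
  length-maxa = begin
    length (maxa u)                                   ≡⟨ length-reverse (filterᵇ (inMaxa u) (positions u)) ⟩
    length (filterᵇ (inMaxa u) (positions u))         ≡⟨ length-filterᵇ (inMaxa u) (positions u) ⟩
    countᵇ (inMaxa u) (positions u)                   ≡⟨ cong (countᵇ (inMaxa u)) (positions-split u end end≤n) ⟩
    countᵇ (inMaxa u) (interval 1 end ++ after)       ≡⟨ countᵇ-++ (inMaxa u) (interval 1 end) after ⟩
    countᵇ (inMaxa u) (interval 1 end) + countᵇ (inMaxa u) after
      ≡⟨ cong (_+ countᵇ (inMaxa u) after) (countᵇ-none (inMaxa u) (All.map inMaxa-upto-end (All-Within-interval 1 end))) ⟩
    countᵇ (inMaxa u) after                           ≡⟨ maxa-rank end ≤-refl end≤n ⟩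
    countᵇ (λ y → suc y ≡ᵇ M) (drop end u)            ≡⟨ cong (countᵇ (λ y → suc y ≡ᵇ M)) drop-end ⟩
    countᵇ (λ y → suc y ≡ᵇ M) suffix                  ∎
    where
    after = interval (suc end) (n ∸ end)

Indexed-reverse-filterᵇ : ∀ {Q} k (P : ℕ → Bool) w →
  (∀ j → 1 ≤ j → j ≤ length w → P j ≡ true → Q j (k + countᵇ P (interval (suc j) (length w ∸ j)))) →
  Indexed Q k (reverse (filterᵇ P (positions w)))
Indexed-reverse-filterᵇ {Q} k P w h =
  Indexed-reverse (filterᵇ P (positions w))
    (subst (λ ps → IndexedByTail (λ x j → Q x (k + j)) (filterᵇ P ps)) (sym (positions-interval w))
      (filterᵇ-IndexedByTail P (λ x j → Q x (k + j)) (suc (length w)) 1 (length w) refl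
        (λ j 1≤j j<1+n → h j 1≤j (≤-pred j<1+n))))

IsArea-head : ∀ {u x r} → u ≡ x ∷ r → IsArea u → x ≡ 0
IsArea-head refl (x≡0 , _) = x≡0

IsArea⇒Chain : ∀ u → IsArea u → Chain u
IsArea⇒Chain []      _       = tt
IsArea⇒Chain (x ∷ r) (_ , c) = c

length-take-≤ : ∀ c (w : List ℕ) → c ≤ length w → length (take c w) ≡ c
length-take-≤ c w c≤n = trans (length-take c w) (m≤n⇒m⊓n≡m c≤n)

countᵇ-≡ᵇ-< : ∀ {M} xs → All (_< M) xs → countᵇ (_≡ᵇ M) xs ≡ 0
countᵇ-≡ᵇ-< {M} xs xs< = countᵇ-none (_≡ᵇ M) (All.map (λ x< → ≡ᵇ-false (<⇒≢ x<)) xs<)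

countᵇ-dinvPair-before : ∀ m xs → All (_≤ m) xs → countᵇ (λ y → dinvPair y m) xs ≡ countᵇ (_≡ᵇ m) xs
countᵇ-dinvPair-before m xs xs≤ = countᵇ-cong xs≤ (λ {y} y≤m →
  trans (cong₂ _∨_ (≡ᵇ-sym m y) (≡ᵇ-false {suc m} {y} (λ e → <-irrefl (sym e) (s≤s y≤m)))) (∨-identityʳ _))

countᵇ-dinvPair-after : ∀ m xs → All (_< m) xs → countᵇ (dinvPair m) xs ≡ countᵇ (λ z → suc z ≡ᵇ m) xs
countᵇ-dinvPair-after m xs xs< = countᵇ-cong xs< (λ {z} z<m → cong (_∨ (suc z ≡ᵇ m)) (≡ᵇ-false (<⇒≢ z<m)))

insertedLetter : ℕ → List ℕ → ℕ
insertedLetter zero    w = 0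
insertedLetter (suc i) w = suc (nth w i)

ins-split : ∀ c w {x} → insertedLetter c w ≡ x → ins c w ≡ take c w ++ x ∷ drop c w
ins-split zero    w refl = refl
ins-split (suc c) w refl = refl

dinv-ins : ∀ c w {x} → insertedLetter c w ≡ x →
  dinv (ins c w) ≡ dinv w + countᵇ (λ y → dinvPair y x) (take c w) + countᵇ (dinvPair x) (drop c w)
dinv-ins c w {x} e = begin
  dinv (ins c w)
    ≡⟨ cong dinv (ins-split c w e) ⟩
  dinv (take c w ++ x ∷ drop c w)
    ≡⟨ dinv-insert (take c w) x (drop c w) ⟩
  dinv (take c w ++ drop c w) + countᵇ (λ y → dinvPair y x) (take c w) + countᵇ (dinvPair x) (drop c w)
    ≡⟨ cong (λ z → dinv z + countᵇ (λ y → dinvPair y x) (take c w) + countᵇ (dinvPair x) (drop c w)) (take++drop≡id c w) ⟩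
  dinv w + countᵇ (λ y → dinvPair y x) (take c w) + countᵇ (dinvPair x) (drop c w) ∎

countᵇ-ins : ∀ (p : ℕ → Bool) c w {x} → insertedLetter c w ≡ x → countᵇ p (ins c w) ≡ countᵇ p w + (if p x then 1 else 0)
countᵇ-ins p c w {x} e = begin
  countᵇ p (ins c w)                                  ≡⟨ cong (countᵇ p) (ins-split c w e) ⟩
  countᵇ p (take c w ++ x ∷ drop c w)                 ≡⟨ countᵇ-++ p (take c w) (x ∷ drop c w) ⟩
  countᵇ p (take c w) + countᵇ p (x ∷ drop c w)       ≡⟨ cong (countᵇ p (take c w) +_) (countᵇ-∷ p x (drop c w)) ⟩
  countᵇ p (take c w) + (δ + countᵇ p (drop c w))     ≡⟨ regroup (countᵇ p (take c w)) δ (countᵇ p (drop c w)) ⟩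
  (countᵇ p (take c w) + countᵇ p (drop c w)) + δ     ≡⟨ cong (_+ δ) (sym (countᵇ-++ p (take c w) (drop c w))) ⟩
  countᵇ p (take c w ++ drop c w) + δ                 ≡⟨ cong (λ z → countᵇ p z + δ) (take++drop≡id c w) ⟩
  countᵇ p w + δ                                      ∎
  where
  δ = if p x then 1 else 0
  regroup : ∀ a d b → a + (d + b) ≡ (a + b) + d
  regroup = solve-∀

InsertionFacts : List ℕ → ℕ → ℕ → Set
InsertionFacts w c k = (dinv (ins c w) ≡ dinv w + k)
                     × (length (admissible (ins c w)) ≡ k + 2)
                     × (val (ins c w) (suc c) ≡ maxL (ins c w))
                     × (i0 (ins c w) ≡ suc c)

length-admissible : ∀ u → 0 < length u → length (admissible u) ≡ length (maxb u) + (length (maxa u) + 1)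
length-admissible (x ∷ xs) _ =
  trans (length-++ (maxb (x ∷ xs))) (cong (length (maxb (x ∷ xs)) +_) (length-++ (maxa (x ∷ xs))))

insertionFacts-of-block : ∀ w c k {M} (b : RightmostBlock (ins c w) M) → length (RightmostBlock.prefix b) ≡ c →
  dinv (ins c w) ≡ dinv w + k →
  countᵇ (_≡ᵇ M) (ins c w) + (countᵇ (λ y → suc y ≡ᵇ M) (RightmostBlock.suffix b) + 1) ≡ k + 2 →
  InsertionFacts w c k
insertionFacts-of-block w c k b start≡c dinv≡ count≡ =
    dinv≡
  , trans (length-admissible (ins c w) (≤-<-trans z≤n start<n)) (trans (cong₂ (λ p q → p + (q + 1)) length-maxb length-maxa) count≡)
  , subst (λ z → val (ins c w) (suc z) ≡ maxL (ins c w)) start≡c val-start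
  , trans i0≡ (cong suc start≡c)
  where open RightmostBlockFacts b

countᵇ-take : ∀ (p : ℕ → Bool) c w → countᵇ p (drop c w) ≡ 0 → countᵇ p (take c w) ≡ countᵇ p w
countᵇ-take p c w none = begin
  countᵇ p (take c w)                            ≡⟨ sym (+-identityʳ _) ⟩
  countᵇ p (take c w) + 0                        ≡⟨ cong (countᵇ p (take c w) +_) (sym none) ⟩
  countᵇ p (take c w) + countᵇ p (drop c w)      ≡⟨ sym (countᵇ-++ p (take c w) (drop c w)) ⟩
  countᵇ p (take c w ++ drop c w)                ≡⟨ cong (countᵇ p) (take++drop≡id c w) ⟩
  countᵇ p w                                     ∎

countᵇ-ins-max : ∀ c w {m} X → insertedLetter c w ≡ m →
  countᵇ (_≡ᵇ m) (ins c w) + (X + 1) ≡ (countᵇ (_≡ᵇ m) w + X) + 2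
countᵇ-ins-max c w {m} X e = begin
  countᵇ (_≡ᵇ m) (ins c w) + (X + 1)
    ≡⟨ cong (_+ (X + 1)) (countᵇ-ins (_≡ᵇ m) c w e) ⟩
  countᵇ (_≡ᵇ m) w + (if m ≡ᵇ m then 1 else 0) + (X + 1)
    ≡⟨ cong (λ b → countᵇ (_≡ᵇ m) w + (if b then 1 else 0) + (X + 1)) (≡ᵇ-refl m) ⟩
  countᵇ (_≡ᵇ m) w + 1 + (X + 1)
    ≡⟨ regroup (countᵇ (_≡ᵇ m) w) X ⟩
  (countᵇ (_≡ᵇ m) w + X) + 2 ∎
  where
  regroup : ∀ a x → a + 1 + (x + 1) ≡ (a + x) + 2
  regroup = solve-∀

-- c′ + 1 ∈ Maxb(w): the inserted letter m + 1 is the unique maximum of ins c w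
insertionFacts-after-max : ∀ w m → All (_≤ m) w → ∀ c′ → suc c′ ≤ length w → nth w c′ ≡ m →
  InsertionFacts w (suc c′) (countᵇ (_≡ᵇ m) (drop (suc c′) w))
insertionFacts-after-max w m w≤m c′ c≤n e = insertionFacts-of-block w c K b (length-take-≤ c w c≤n) dinv≡ count≡
  where
  c = suc c′
  K = countᵇ (_≡ᵇ m) (drop c w)
  letter : insertedLetter c w ≡ suc m
  letter = cong suc e
  before≤ : All (_≤ m) (take c w)
  before≤ = take⁺ c w≤m
  after≤ : All (_≤ m) (drop c w)
  after≤ = drop⁺ c w≤m
  b : RightmostBlock (ins c w) (suc m)
  b = block (take c w) 0 (drop c w) (ins-split c w letter) (All.map m≤n⇒m≤1+n before≤) (All.map s≤s after≤)
            (λ k _ eq → <-irrefl eq (s≤s (nth-≤ (take c w) k before≤)))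
  before : countᵇ (λ y → dinvPair y (suc m)) (take c w) ≡ 0
  before = trans (countᵇ-dinvPair-before (suc m) (take c w) (All.map m≤n⇒m≤1+n before≤))
                 (countᵇ-≡ᵇ-< (take c w) (All.map s≤s before≤))
  dinv≡ : dinv (ins c w) ≡ dinv w + K
  dinv≡ = begin
    dinv (ins c w)
      ≡⟨ dinv-ins c w letter ⟩
    dinv w + countᵇ (λ y → dinvPair y (suc m)) (take c w) + countᵇ (dinvPair (suc m)) (drop c w)
      ≡⟨ cong₂ (λ p q → dinv w + p + q) before (countᵇ-dinvPair-after (suc m) (drop c w) (All.map s≤s after≤)) ⟩
    dinv w + 0 + K
      ≡⟨ cong (_+ K) (+-identityʳ (dinv w)) ⟩
    dinv w + K ∎
  count≡ : countᵇ (_≡ᵇ suc m) (ins c w) + (K + 1) ≡ K + 2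
  count≡ = begin
    countᵇ (_≡ᵇ suc m) (ins c w) + (K + 1)
      ≡⟨ cong (_+ (K + 1)) (countᵇ-ins (_≡ᵇ suc m) c w letter) ⟩
    countᵇ (_≡ᵇ suc m) w + (if m ≡ᵇ m then 1 else 0) + (K + 1)
      ≡⟨ cong₂ (λ a b → a + (if b then 1 else 0) + (K + 1)) (countᵇ-≡ᵇ-< w (All.map s≤s w≤m)) (≡ᵇ-refl m) ⟩
    suc (K + 1)
      ≡⟨ sym (+-suc K 1) ⟩
    K + 2 ∎

-- c′ + 1 ∈ Maxa(w): the inserted letter m is the last occurrence of m, a block of its own
insertionFacts-after-submax : ∀ w m (b : RightmostBlock w m) c′ → RightmostBlockFacts.end b ≤ c′ →
  suc c′ ≤ length w → suc (nth w c′) ≡ m →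
  InsertionFacts w (suc c′) (countᵇ (_≡ᵇ m) w + countᵇ (λ y → suc y ≡ᵇ m) (drop (suc c′) w))
insertionFacts-after-submax w m b c′ end≤c′ c≤n e =
  insertionFacts-of-block w c (cw + X) b′ (length-take-≤ c w c≤n) dinv≡ (countᵇ-ins-max c w X e)
  where
  open RightmostBlockFacts b using (end; All≤M; drop-end; suffix<)
  c = suc c′
  X = countᵇ (λ y → suc y ≡ᵇ m) (drop c w)
  cw = countᵇ (_≡ᵇ m) w
  end≤c : end ≤ c
  end≤c = m≤n⇒m≤1+n end≤c′
  after< : All (_< m) (drop c w)
  after< = subst (All (_< m)) drop≡ (drop⁺ (c ∸ end) suffix<)
    where
    drop≡ : drop (c ∸ end) (RightmostBlock.suffix b) ≡ drop c w
    drop≡ = trans (cong (drop (c ∸ end)) (sym drop-end))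
              (trans (drop-drop end (c ∸ end) w) (cong (λ z → drop z w) (m+[n∸m]≡n end≤c)))
  last≢ : ∀ k → suc k ≡ length (take c w) → nth (take c w) k ≢ m
  last≢ k e′ eq = 1+n≢n (trans (cong suc (sym nth≡m)) e)
    where
    k≡c′ : k ≡ c′
    k≡c′ = suc-injective (trans e′ (length-take-≤ c w c≤n))
    nth≡m : nth w c′ ≡ m
    nth≡m = trans (sym (nth-take w c c′ ≤-refl)) (subst (λ z → nth (take c w) z ≡ m) k≡c′ eq)
  b′ : RightmostBlock (ins c w) m
  b′ = block (take c w) 0 (drop c w) (ins-split c w e) (take⁺ c All≤M) after< last≢
  dinv≡ : dinv (ins c w) ≡ dinv w + (cw + X)
  dinv≡ = begin
    dinv (ins c w)
      ≡⟨ dinv-ins c w e ⟩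
    dinv w + countᵇ (λ y → dinvPair y m) (take c w) + countᵇ (dinvPair m) (drop c w)
      ≡⟨ cong₂ (λ p q → dinv w + p + q)
               (trans (countᵇ-dinvPair-before m (take c w) (take⁺ c All≤M)) (countᵇ-take (_≡ᵇ m) c w (countᵇ-≡ᵇ-< (drop c w) after<)))
               (countᵇ-dinvPair-after m (drop c w) after<) ⟩
    dinv w + cw + X
      ≡⟨ +-assoc (dinv w) cw X ⟩
    dinv w + (cw + X) ∎

-- i0(w) − 1: the inserted letter extends the rightmost maximal block to the left,
-- because in an area sequence the letter before that block is m − 1 (or there is none and m = 0)
insertionFacts-at-block : ∀ w → IsArea w → ∀ m (b : RightmostBlock w m) →
  InsertionFacts w (RightmostBlockFacts.start b)
                   (countᵇ (_≡ᵇ m) w + countᵇ (λ y → suc y ≡ᵇ m) (RightmostBlock.suffix b))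
insertionFacts-at-block w isArea m b =
  insertionFacts-of-block w start (cw + X) b′ refl dinv≡ (countᵇ-ins-max start w X letter)
  where
  open RightmostBlockFacts b
  X = countᵇ (λ y → suc y ≡ᵇ m) suffix
  cw = countᵇ (_≡ᵇ m) w
  cA = countᵇ (_≡ᵇ m) prefix

  letter : insertedLetter start w ≡ m
  letter = letter-of prefix refl
    where
    letter-of : ∀ xs → xs ≡ prefix → insertedLetter (length xs) w ≡ m
    letter-of []       e = sym (IsArea-head (trans split (cong (_++ _) (sym e))) isArea)
    letter-of (y ∷ xs) e = ≤-antisym (≤∧≢⇒< (nth-≤ w a All≤M) (nth-before-block≢ a 1+a≡start)) m≤1+nth
      where
      a = length xs
      1+a≡start : suc a ≡ start
      1+a≡start = cong length e
      m≤1+nth : m ≤ suc (nth w a)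
      m≤1+nth = subst (_≤ suc (nth w a))
                  (subst (λ z → nth w z ≡ m) (sym 1+a≡start) (nth-block start ≤-refl (s≤s (m≤m+n start extra))))
                  (chain-nth w (IsArea⇒Chain w isArea) a (subst (_< n) (sym 1+a≡start) start<n))

  b′ : RightmostBlock (ins start w) m
  b′ = block prefix (suc extra) suffix
         (trans (ins-split start w letter) (cong₂ (λ p q → p ++ m ∷ q) take-start drop-start))
         prefix≤ suffix< prefix-last≢

  count-w : cw ≡ cA + suc extra
  count-w = begin
    cw
      ≡⟨ cong (countᵇ (_≡ᵇ m)) split ⟩
    countᵇ (_≡ᵇ m) (prefix ++ (replicate (suc extra) m ++ suffix))
      ≡⟨ countᵇ-++ (_≡ᵇ m) prefix _ ⟩
    cA + countᵇ (_≡ᵇ m) (replicate (suc extra) m ++ suffix)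
      ≡⟨ cong (cA +_) (countᵇ-++ (_≡ᵇ m) (replicate (suc extra) m) suffix) ⟩
    cA + (countᵇ (_≡ᵇ m) (replicate (suc extra) m) + countᵇ (_≡ᵇ m) suffix)
      ≡⟨ cong₂ (λ p q → cA + (p + q)) (countᵇ-replicate (_≡ᵇ m) {m} (suc extra) (≡ᵇ-refl m)) (countᵇ-≡ᵇ-< suffix suffix<) ⟩
    cA + (suc extra + 0)
      ≡⟨ cong (cA +_) (+-identityʳ (suc extra)) ⟩
    cA + suc extra ∎

  after : countᵇ (dinvPair m) (drop start w) ≡ suc extra + X
  after = begin
    countᵇ (dinvPair m) (drop start w)
      ≡⟨ cong (countᵇ (dinvPair m)) drop-start ⟩
    countᵇ (dinvPair m) (replicate (suc extra) m ++ suffix)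
      ≡⟨ countᵇ-++ (dinvPair m) (replicate (suc extra) m) suffix ⟩
    countᵇ (dinvPair m) (replicate (suc extra) m) + countᵇ (dinvPair m) suffix
      ≡⟨ cong₂ _+_ (countᵇ-replicate (dinvPair m) {m} (suc extra) (cong (_∨ (suc m ≡ᵇ m)) (≡ᵇ-refl m))) (countᵇ-dinvPair-after m suffix suffix<) ⟩
    suc extra + X ∎

  dinv≡ : dinv (ins start w) ≡ dinv w + (cw + X)
  dinv≡ = begin
    dinv (ins start w)
      ≡⟨ dinv-ins start w letter ⟩
    dinv w + countᵇ (λ y → dinvPair y m) (take start w) + countᵇ (dinvPair m) (drop start w)
      ≡⟨ cong₂ (λ p q → dinv w + p + q)
               (trans (cong (countᵇ (λ y → dinvPair y m)) take-start) (countᵇ-dinvPair-before m prefix prefix≤)) after ⟩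
    dinv w + cA + (suc extra + X)
      ≡⟨ regroup (dinv w) cA (suc extra) X ⟩
    dinv w + ((cA + suc extra) + X)
      ≡⟨ cong (λ z → dinv w + (z + X)) (sym count-w) ⟩
    dinv w + (cw + X) ∎
    where
    regroup : ∀ d a e x → d + a + (e + x) ≡ d + ((a + e) + x)
    regroup = solve-∀

insertionFacts-admissible : ∀ x xs → IsArea (x ∷ xs) → Indexed (InsertionFacts (x ∷ xs)) 0 (admissible (x ∷ xs))
insertionFacts-admissible x xs isArea =
  Indexed-++ (maxb w) _ maxb-facts (Indexed-++ (maxa w) _ maxa-facts (i0-facts , tt))
  where
  w = x ∷ xs
  m = maxL w
  b = maxBlock x xs
  open RightmostBlockFacts b

  at-maxb : ∀ j → 1 ≤ j → j ≤ length w → inMaxb w j ≡ true →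
    InsertionFacts w j (countᵇ (inMaxb w) (interval (suc j) (length w ∸ j)))
  at-maxb (suc c′) _ c≤n e =
    subst (InsertionFacts w (suc c′)) (sym (maxb-rank (suc c′))) (insertionFacts-after-max w m All≤M c′ c≤n (≡ᵇ-sound e))

  maxb-facts : Indexed (InsertionFacts w) 0 (maxb w)
  maxb-facts = Indexed-reverse-filterᵇ 0 (inMaxb w) w at-maxb

  at-maxa : ∀ j → 1 ≤ j → j ≤ length w → inMaxa w j ≡ true →
    InsertionFacts w j (length (maxb w) + countᵇ (inMaxa w) (interval (suc j) (length w ∸ j)))
  at-maxa (suc c′) _ c≤n e with suc c′ ≤? end
  ... | yes c≤end = ⊥-elim (false≢true (trans (sym (inMaxa-upto-end (s≤s z≤n , s≤s c≤end))) e))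
    where
    false≢true : false ≢ true
    false≢true ()
  ... | no c≰end =
    subst₂ (λ p q → InsertionFacts w (suc c′) (p + q)) (sym length-maxb) (sym (maxa-rank (suc c′) end≤c c≤n))
      (insertionFacts-after-submax w m b c′ (≤-pred end<c) c≤n (≡ᵇ-sound (∧-trueˡ e)))
    where
    end<c : end < suc c′
    end<c = ≰⇒> c≰end
    end≤c : end ≤ suc c′
    end≤c = <⇒≤ end<c

  maxa-facts : Indexed (InsertionFacts w) (0 + length (maxb w)) (maxa w)
  maxa-facts = Indexed-reverse-filterᵇ (length (maxb w)) (inMaxa w) w at-maxa

  i0-facts : InsertionFacts w (i0 w ∸ 1) (0 + length (maxb w) + length (maxa w))
  i0-facts = subst₂ (InsertionFacts w) (sym (cong (_∸ 1) i0≡)) (sym (cong₂ _+_ length-maxb length-maxa))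
               (insertionFacts-at-block w isArea m b)

proposition2p2 : (w : List ℕ) → IsArea w → (i : Fin (length (admissible w))) →
    (dinv (ins (lookup (admissible w) i) w) ≡ dinv w + toℕ i)
    × (length (admissible (ins (lookup (admissible w) i) w)) ≡ toℕ i + 2)
    × (val (ins (lookup (admissible w) i) w) (suc (lookup (admissible w) i))
         ≡ maxL (ins (lookup (admissible w) i) w))
    × (i0 (ins (lookup (admissible w) i) w) ≡ suc (lookup (admissible w) i))
proposition2p2 []       _      Fin.zero = refl , refl , refl , refl
proposition2p2 (x ∷ xs) isArea i        =
  Indexed-lookup (admissible (x ∷ xs)) (insertionFacts-admissible x xs isArea) i
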